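{- Let $G$ be a finite simple graph with chromatic number $\chi$ and let $k\ge1$. Then the $k$-supertoken graph satisfies $\chi(\mathcal F_k(G))\le\chi$.
   Context: The $k$-supertoken graph $\mathcal F_k(G)$ has as vertices all multisets of size $k$ of elements of $V(G)$; two multisets $A,B$ are adjacent iff $A=S\uplus\{u\}$, $B=S\uplus\{v\}$ for some multiset $S$ of size $k-1$ and some edge $uv\in E(G)$, where $\uplus$ is multiset sum. -}

module Defs where

open import Data.Nat using (ℕ; zero; suc; _+_; _∸_; _≤_)
open import Data.Fin using (Fin; zero; suc; _≟_)
open import Data.Product using (Σ; ∃; ∃-syntax; _×_; _,_)
open import Relation.Nullary using (¬_; yes; no)
open import Relation.Binary.PropositionalEquality using (_≡_)

record Graph (V : Set) : Set₁ where
  field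
    Adj : V → V → Set
open Graph public

IsSimple : {V : Set} → Graph V → Set
IsSimple {V} G = (∀ u v → Adj G u v → Adj G v u) × (∀ u → ¬ Adj G u u)

Colorable : {V : Set} → Graph V → ℕ → Set
Colorable {V} G c = Σ (V → Fin c) λ f → ∀ u v → Adj G u v → ¬ (f u ≡ f v)

IsChromaticNumber : {V : Set} → Graph V → ℕ → Set
IsChromaticNumber G χ = Colorable G χ × (∀ c → Colorable G c → χ ≤ c)

Multiset : ℕ → Set
Multiset n = Fin n → ℕ

size : ∀ {n} → Multiset n → ℕ
size {zero}  m = 0
size {suc n} m = m zero + size (λ i → m (suc i))

single : ∀ {n} → Fin n → Multiset n
single u i with u ≟ i
... | yes _ = 1
... | no  _ = 0

_⊎ₘ_ : ∀ {n} → Multiset n → Multiset n → Multiset n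
(a ⊎ₘ b) i = a i + b i

_≐_ : ∀ {n} → Multiset n → Multiset n → Set
a ≐ b = ∀ i → a i ≡ b i

SupertokenVertex : ℕ → ℕ → Set
SupertokenVertex n k = Σ (Multiset n) λ m → size m ≡ k

SupertokenAdj : ∀ {n} (G : Graph (Fin n)) (k : ℕ) →
  SupertokenVertex n k → SupertokenVertex n k → Set
SupertokenAdj {n} G k (A , _) (B , _) =
  Σ (Multiset n) λ S → size S ≡ k ∸ 1 × ∃[ u ] ∃[ v ]
    (Adj G u v × A ≐ (S ⊎ₘ single u) × B ≐ (S ⊎ₘ single v))

Supertoken : ∀ {n} → Graph (Fin n) → (k : ℕ) → Graph (SupertokenVertex n k)
Supertoken G k = record { Adj = SupertokenAdj G k }

-- Colour a multiset of tokens by the sum of the colours of its tokens, taken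
-- modulo χ: moving one token along an edge uv changes that sum by f(v) − f(u),
-- which is nonzero modulo χ because 0 ≤ f(u), f(v) < χ and f(u) ≠ f(v).
-- Conversely, parking k − 1 tokens on a fixed vertex embeds G in F_k(G), so
-- in fact χ(F_k(G)) = χ.
module Submission where

open import Defs
open import Data.Nat using (ℕ; _≤_)
open import Data.Fin using (Fin)
open import Data.Product using (Σ; _×_)

open import Data.Empty using (⊥-elim)
open import Data.Fin as Fin using (zero; suc; toℕ)
open import Data.Fin.Properties using (¬Fin0; toℕ<n; toℕ-injective; toℕ-fromℕ<)
open import Data.Nat using (zero; suc; _+_; _*_; _∸_; _<_; NonZero)
open import Data.Nat.DivMod using (_%_; _mod_; %-distribˡ-+; [m+kn]%n≡m%n; m<n⇒m%n≡m)
open import Data.Nat.Properties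
  using (+-*-semiring; *-distribʳ-+; *-identityˡ; *-identityʳ; +-identityʳ; <-irrefl; m∸n+n≡m; ≤-refl)
open import Data.Nat.Solver using (module +-*-Solver)
open import Data.Product using (_,_)
open import Function using (_∘_)
open import Relation.Nullary using (¬_; yes; no)
open import Relation.Binary.PropositionalEquality
open import Algebra.Properties.Semiring.Sum +-*-semiring
  using (sum-syntax; sum-cong-≗; ∑-distrib-+; sum-replicate-zero)

private
  variable
    n c k : ℕ
    V W : Set

weight : Multiset n → (Fin n → ℕ) → ℕ
weight {n} A g = ∑[ i < n ] (A i * g i)

weight-cong : ∀ {A B : Multiset n} g → A ≐ B → weight A g ≡ weight B g
weight-cong g A≐B = sum-cong-≗ λ i → cong (_* g i) (A≐B i)

weight-⊎ₘ : ∀ (A B : Multiset n) g → weight (A ⊎ₘ B) g ≡ weight A g + weight B g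
weight-⊎ₘ A B g = trans (sum-cong-≗ λ i → *-distribʳ-+ (g i) (A i) (B i))
                        (∑-distrib-+ (λ i → A i * g i) (λ i → B i * g i))

single-suc : ∀ (u i : Fin n) → single (suc u) (suc i) ≡ single u i
single-suc u i with u Fin.≟ i
... | yes _ = refl
... | no  _ = refl

weight-single : ∀ (u : Fin n) g → weight (single u) g ≡ g u
weight-single {suc n} zero g =
  trans (cong₂ _+_ (*-identityˡ (g zero)) (sum-replicate-zero n)) (+-identityʳ (g zero))
weight-single {suc n} (suc u) g =
  trans (sum-cong-≗ λ i → cong (_* g (suc i)) (single-suc u i)) (weight-single u (g ∘ suc))

weight-insert : ∀ {A S : Multiset n} {u} g → A ≐ (S ⊎ₘ single u) → weight A g ≡ weight S g + g u
weight-insert {A = A} {S} {u} g A≐S+u = begin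
  weight A g                        ≡⟨ weight-cong g A≐S+u ⟩
  weight (S ⊎ₘ single u) g          ≡⟨ weight-⊎ₘ S (single u) g ⟩
  weight S g + weight (single u) g  ≡⟨ cong (weight S g +_) (weight-single u g) ⟩
  weight S g + g u                  ∎
  where open ≡-Reasoning

size≡weight-1 : ∀ (A : Multiset n) → size A ≡ weight A (λ _ → 1)
size≡weight-1 {zero}  A = refl
size≡weight-1 {suc n} A = cong₂ _+_ (sym (*-identityʳ (A zero))) (size≡weight-1 (A ∘ suc))

size-⊎ₘ : ∀ (A B : Multiset n) → size (A ⊎ₘ B) ≡ size A + size B
size-⊎ₘ A B = begin
  size (A ⊎ₘ B)                                 ≡⟨ size≡weight-1 (A ⊎ₘ B) ⟩
  weight (A ⊎ₘ B) (λ _ → 1)                     ≡⟨ weight-⊎ₘ A B (λ _ → 1) ⟩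
  weight A (λ _ → 1) + weight B (λ _ → 1)       ≡⟨ sym (cong₂ _+_ (size≡weight-1 A) (size≡weight-1 B)) ⟩
  size A + size B                               ∎
  where open ≡-Reasoning

size-single : ∀ (u : Fin n) → size (single u) ≡ 1
size-single u = trans (size≡weight-1 (single u)) (weight-single u (λ _ → 1))

size-∅ : size {n} (λ _ → 0) ≡ 0
size-∅ {zero}  = refl
size-∅ {suc n} = size-∅ {n}

+-cancelˡ-% : ∀ s a b m .{{_ : NonZero m}} → (s + a) % m ≡ (s + b) % m → a % m ≡ b % m
+-cancelˡ-% s a b m@(suc m-1) eq = begin
  a % m                      ≡⟨ sym (add-inverse a) ⟩
  (t + (s + a)) % m          ≡⟨ %-distribˡ-+ t (s + a) m ⟩
  (t % m + (s + a) % m) % m  ≡⟨ cong (λ r → (t % m + r) % m) eq ⟩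
  (t % m + (s + b) % m) % m  ≡⟨ sym (%-distribˡ-+ t (s + b) m) ⟩
  (t + (s + b)) % m          ≡⟨ add-inverse b ⟩
  b % m                      ∎
  where
  open ≡-Reasoning
  open +-*-Solver
  -- t + s = m s, so t acts as −s modulo m.
  t : ℕ
  t = m-1 * s
  add-inverse : ∀ x → (t + (s + x)) % m ≡ x % m
  add-inverse x = trans
    (cong (_% m) (solve 3 (λ p s x → p :* s :+ (s :+ x) := x :+ s :* (con 1 :+ p)) refl m-1 s x))
    ([m+kn]%n≡m%n x s m)

+-cancelˡ-%-< : ∀ s {a b m} .{{_ : NonZero m}} → a < m → b < m → (s + a) % m ≡ (s + b) % m → a ≡ b
+-cancelˡ-%-< s {a} {b} {m} a<m b<m eq =
  trans (sym (m<n⇒m%n≡m a<m)) (trans (+-cancelˡ-% s a b m eq) (m<n⇒m%n≡m b<m))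

supertoken-colorable-suc : {G : Graph (Fin n)} → Colorable G (suc c) → Colorable (Supertoken G k) (suc c)
supertoken-colorable-suc {n} {c} {k} {G} (f , f-proper) = colour , colour-proper
  where
  g : Fin n → ℕ
  g = toℕ ∘ f

  colour : SupertokenVertex n k → Fin (suc c)
  colour (A , _) = weight A g mod suc c

  colour-proper : ∀ a b → SupertokenAdj G k a b → ¬ colour a ≡ colour b
  colour-proper a@(A , _) b@(B , _) (S , _ , u , v , uv , A≐S+u , B≐S+v) same-colour =
    f-proper u v uv (toℕ-injective (+-cancelˡ-%-< (weight S g) (toℕ<n (f u)) (toℕ<n (f v)) sums≡))
    where
    open ≡-Reasoning
    sums≡ : (weight S g + g u) % suc c ≡ (weight S g + g v) % suc c
    sums≡ = begin
      (weight S g + g u) % suc c  ≡⟨ cong (_% suc c) (weight-insert g A≐S+u) ⟨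
      weight A g % suc c          ≡⟨ toℕ-fromℕ< _ ⟨
      toℕ (colour a)              ≡⟨ cong toℕ same-colour ⟩
      toℕ (colour b)              ≡⟨ toℕ-fromℕ< _ ⟩
      weight B g % suc c          ≡⟨ cong (_% suc c) (weight-insert g B≐S+v) ⟩
      (weight S g + g v) % suc c  ∎

supertoken-colorable : {G : Graph (Fin n)} → 1 ≤ k → Colorable G c → Colorable (Supertoken G k) c
supertoken-colorable {c = suc c} _ = supertoken-colorable-suc
supertoken-colorable {n = suc n} {c = zero} _ (f , _) = ⊥-elim (¬Fin0 (f zero))
supertoken-colorable {n = zero} {k} {zero} 1≤k _ =
  (λ x → ⊥-elim (no-vertex x)) , (λ x → ⊥-elim (no-vertex x))
  where
  no-vertex : ¬ SupertokenVertex 0 k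
  no-vertex (_ , 0≡k) = <-irrefl 0≡k 1≤k

_⇒ᴳ_ : Graph V → Graph W → Set
_⇒ᴳ_ {V} {W} G H = Σ (V → W) λ h → ∀ u v → Adj G u v → Adj H (h u) (h v)

colorable-pullback : {G : Graph V} {H : Graph W} → G ⇒ᴳ H → Colorable H c → Colorable G c
colorable-pullback (h , h-hom) (f , f-proper) = f ∘ h , λ u v uv → f-proper (h u) (h v) (h-hom u v uv)

parked : ℕ → Multiset (suc n)
parked m zero    = m
parked m (suc _) = 0

size-parked : ∀ m → size (parked {n} m) ≡ m
size-parked {n} m = trans (cong (m +_) (size-∅ {n})) (+-identityʳ m)

supertoken-embedding : {G : Graph (Fin (suc n))} → 1 ≤ k → G ⇒ᴳ Supertoken G k
supertoken-embedding {n} {k} 1≤k = token , λ u v uv →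
  S , size-parked {n} (k ∸ 1) , u , v , uv , (λ _ → refl) , (λ _ → refl)
  where
  open ≡-Reasoning
  S : Multiset (suc n)
  S = parked (k ∸ 1)
  token : Fin (suc n) → SupertokenVertex (suc n) k
  token u = S ⊎ₘ single u , (begin
    size (S ⊎ₘ single u)      ≡⟨ size-⊎ₘ S (single u) ⟩
    size S + size (single u)  ≡⟨ cong₂ _+_ (size-parked {n} (k ∸ 1)) (size-single u) ⟩
    k ∸ 1 + 1                 ≡⟨ m∸n+n≡m 1≤k ⟩
    k                         ∎)

colorable-of-supertoken : {G : Graph (Fin n)} → 1 ≤ k → Colorable (Supertoken G k) c → Colorable G c
colorable-of-supertoken {zero}  _   _ = (λ ()) , λ ()
colorable-of-supertoken {suc n} 1≤k   = colorable-pullback (supertoken-embedding 1≤k)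

supertoken-chromaticNumber : {G : Graph (Fin n)} {χ : ℕ} → 1 ≤ k →
  IsChromaticNumber G χ → IsChromaticNumber (Supertoken G k) χ
supertoken-chromaticNumber 1≤k (χ-colorable , χ-minimal) =
  supertoken-colorable 1≤k χ-colorable , λ c colorable → χ-minimal c (colorable-of-supertoken 1≤k colorable)

mainTheorem9 : (n : ℕ) (G : Graph (Fin n)) → IsSimple G →
    (χ : ℕ) → IsChromaticNumber G χ → (k : ℕ) → 1 ≤ k →
    Σ ℕ (λ χ' → IsChromaticNumber (Supertoken G k) χ' × χ' ≤ χ)
mainTheorem9 n G _ χ χ-chromatic k 1≤k = χ , supertoken-chromaticNumber 1≤k χ-chromatic , ≤-refl
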